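{- For every integer $n\ge 2$, $$v(n\text{ - }pl)=3^{n-1}\,v(1\text{ - }pl)+R,\qquad R=\sum_{m=1}^{n-1}3^{\,n-1-m}\sum_{j=1}^{m}C_j\,h_{m,j},$$ where $C_j=2j^2-5j+4$.
   Context: For positive integers $n,m$ with $m\le n$, the Goodman–Savage number is $h_{n,m}=\sum_{r=0}^{m}(-1)^r\frac{(m-r)^n}{(m-r)!\,r!}$ (convention $0^0=1$). The Goodman–Fine number (Goodman's maximum primary complexity value of an $n$-place predicate) is defined for each positive integer $n$ by $$v(n\text{ - }pl)=\sum_{k=1}^{n}\sum_{r=0}^{k}(-1)^r\,(2k-1)\,\frac{(k-r)^n}{(k-r)!\,r!}.$$ -}

module Defs where

open import Data.Nat as ℕ using (ℕ; zero; suc; _∸_)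
open import Data.Nat.Properties using (_!*_!≢0)
open import Data.Nat using (_!)
open import Data.Integer as ℤ using (ℤ; +_)
open import Data.Rational using (ℚ; 0ℚ; 1ℚ; _+_; _*_; -_; _/_)

-- Σ[ i ∈ a .. b ] f i : sum of f i for a ≤ i ≤ b (empty, i.e. 0, if b < a)
-- sumFrom a k f = f a + f (a+1) + ... + f (a+k-1)
sumFrom : ℕ → ℕ → (ℕ → ℚ) → ℚ
sumFrom a zero    f = 0ℚ
sumFrom a (suc k) f = f a + sumFrom (suc a) k f

Σ[_⋯_] : ℕ → ℕ → (ℕ → ℚ) → ℚ
Σ[ a ⋯ b ] f = sumFrom a (suc b ∸ a) f

sign : ℕ → ℚ
sign zero    = 1ℚ
sign (suc r) = - sign r

ℕ→ℚ : ℕ → ℚ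
ℕ→ℚ k = (+ k) / 1

-- the term (m-r)^n / ((m-r)! r!), with 0^0 = 1 (as ℕ._^_ gives)
term : ℕ → ℕ → ℕ → ℚ
term n m r = _/_ (+ ((m ∸ r) ℕ.^ n)) ((m ∸ r) ! ℕ.* r !) {{(m ∸ r) !* r !≢0}}

h : ℕ → ℕ → ℚ
h n m = Σ[ 0 ⋯ m ] (λ r → sign r * term n m r)

v : ℕ → ℚ
v n = Σ[ 1 ⋯ n ] (λ k → Σ[ 0 ⋯ k ] (λ r → sign r * ℕ→ℚ (2 ℕ.* k ∸ 1) * term n k r))

C : ℕ → ℚ
C j = ℕ→ℚ (2 ℕ.* j ℕ.* j) + (- ℕ→ℚ (5 ℕ.* j)) + ℕ→ℚ 4

R : ℕ → ℚ
R n = Σ[ 1 ⋯ n ∸ 1 ] (λ m → ℕ→ℚ (3 ℕ.^ (n ∸ 1 ∸ m)) * Σ[ 1 ⋯ m ] (λ j → C j * h m j))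

-- The Goodman–Savage numbers h n k are the Stirling numbers of the second kind: they
-- satisfy h (n+1) (k+1) = (k+1) h n (k+1) + h n k and vanish for n < k (for n = 0 this
-- follows by comparing that recurrence with h 1 (k+1) = h 0 k). Feeding the recurrence
-- into v n = Σ_k (2k-1) h n k gives, for n ≥ 1 (so that h n 0 = 0 = h n (n+1)),
-- v (n+1) = Σ_k (k(2k-1) + (2k+1)) h n k, and since k(2k-1) + (2k+1) = 3(2k-1) + C k,
-- this is v (n+1) = 3 v n + Σ_k C k h n k.
-- Unrolling this first-order recurrence down to v 1 is the formula.

module Submission where

open import Defs
open import Data.Nat as ℕ using (ℕ; zero; suc; _≤_; _<_; _∸_; _!; s≤s; z≤n)
import Data.Nat.Properties as ℕ
import Data.Nat.Tactic.RingSolver as ℕ-Solver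
import Data.Integer as ℤ
import Data.Integer.Properties as ℤ
open import Data.Rational using (ℚ; 0ℚ; 1ℚ; _+_; _*_; -_; _/_; 1/_; NonZero; toℚᵘ; fromℚᵘ)
open import Data.Rational.Properties
import Data.Rational.Unnormalised as ℚᵘ
import Data.Rational.Unnormalised.Properties as ℚᵘ
open import Data.Maybe using (Maybe; just; nothing)
open import Relation.Binary.PropositionalEquality
open import Relation.Nullary using (yes; no)
import Algebra.Properties.Group +-0-group as +-Group
open import Tactic.RingSolver using (solve-∀)
open import Tactic.RingSolver.Core.AlmostCommutativeRing using (AlmostCommutativeRing; fromCommutativeRing)

ℚ-ring : AlmostCommutativeRing _ _
ℚ-ring = fromCommutativeRing +-*-commutativeRing isZero
  where
  isZero : ∀ p → Maybe (0ℚ ≡ p)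
  isZero p with 0ℚ ≟ p
  ... | yes 0≡p = just 0≡p
  ... | no _    = nothing

fromℚᵘ-homo-+ : ∀ p q → fromℚᵘ (p ℚᵘ.+ q) ≡ fromℚᵘ p + fromℚᵘ q
fromℚᵘ-homo-+ p q = trans (fromℚᵘ-cong (ℚᵘ.≃-sym (begin
  toℚᵘ (fromℚᵘ p + fromℚᵘ q)            ≈⟨ toℚᵘ-homo-+ (fromℚᵘ p) (fromℚᵘ q) ⟩
  toℚᵘ (fromℚᵘ p) ℚᵘ.+ toℚᵘ (fromℚᵘ q)  ≈⟨ ℚᵘ.+-cong (toℚᵘ-fromℚᵘ p) (toℚᵘ-fromℚᵘ q) ⟩
  p ℚᵘ.+ q                              ∎))) (fromℚᵘ-toℚᵘ _)
  where open ℚᵘ.≃-Reasoning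

fromℚᵘ-homo-* : ∀ p q → fromℚᵘ (p ℚᵘ.* q) ≡ fromℚᵘ p * fromℚᵘ q
fromℚᵘ-homo-* p q = trans (fromℚᵘ-cong (ℚᵘ.≃-sym (begin
  toℚᵘ (fromℚᵘ p * fromℚᵘ q)            ≈⟨ toℚᵘ-homo-* (fromℚᵘ p) (fromℚᵘ q) ⟩
  toℚᵘ (fromℚᵘ p) ℚᵘ.* toℚᵘ (fromℚᵘ q)  ≈⟨ ℚᵘ.*-cong (toℚᵘ-fromℚᵘ p) (toℚᵘ-fromℚᵘ q) ⟩
  p ℚᵘ.* q                              ∎))) (fromℚᵘ-toℚᵘ _)
  where open ℚᵘ.≃-Reasoning

fromℚᵘ-/ : ∀ p d .{{_ : ℕ.NonZero d}} → fromℚᵘ (p ℚᵘ./ d) ≡ p / d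
fromℚᵘ-/ p (suc d) = refl

/-homo-* : ∀ p q b d .{{_ : ℕ.NonZero b}} .{{_ : ℕ.NonZero d}} →
           (p / b) * (q / d) ≡ ((p ℤ.* q) / (b ℕ.* d)) {{ℕ.m*n≢0 b d}}
/-homo-* p q (suc b) (suc d) = sym (fromℚᵘ-homo-* (ℚᵘ.mkℚᵘ p b) (ℚᵘ.mkℚᵘ q d))

/-homo-+ : ∀ p q b d .{{_ : ℕ.NonZero b}} .{{_ : ℕ.NonZero d}} →
           (p / b) + (q / d) ≡ ((p ℤ.* ℤ.+ d ℤ.+ q ℤ.* ℤ.+ b) / (b ℕ.* d)) {{ℕ.m*n≢0 b d}}
/-homo-+ p q (suc b) (suc d) = sym (fromℚᵘ-homo-+ (ℚᵘ.mkℚᵘ p b) (ℚᵘ.mkℚᵘ q d))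

*-cancelˡ-/ : ∀ c {p d} .{{_ : ℕ.NonZero d}} .{{_ : ℕ.NonZero (c ℕ.* d)}} →
              (ℤ.+ c ℤ.* p) / (c ℕ.* d) ≡ p / d
*-cancelˡ-/ c {p} {d} = begin
  (ℤ.+ c ℤ.* p) / (c ℕ.* d)              ≡⟨ fromℚᵘ-/ (ℤ.+ c ℤ.* p) (c ℕ.* d) ⟨
  fromℚᵘ ((ℤ.+ c ℤ.* p) ℚᵘ./ (c ℕ.* d))  ≡⟨ fromℚᵘ-cong (ℚᵘ.*-cancelˡ-/ c) ⟩
  fromℚᵘ (p ℚᵘ./ d)                    ≡⟨ fromℚᵘ-/ p d ⟩
  p / d                                ∎
  where open ≡-Reasoning

ℕ→ℚ-*-/ : ∀ e a d .{{_ : ℕ.NonZero d}} → ℕ→ℚ e * (ℤ.+ a / d) ≡ ℤ.+ (e ℕ.* a) / d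
ℕ→ℚ-*-/ e a d = trans (/-homo-* (ℤ.+ e) (ℤ.+ a) 1 d)
                      (/-cong {{ℕ.m*n≢0 1 d}} (sym (ℤ.pos-* e a)) (ℕ.*-identityˡ d))

ℕ→ℚ-* : ∀ a b → ℕ→ℚ (a ℕ.* b) ≡ ℕ→ℚ a * ℕ→ℚ b
ℕ→ℚ-* a b = sym (ℕ→ℚ-*-/ a b 1)

ℕ→ℚ-+ : ∀ a b → ℕ→ℚ (a ℕ.+ b) ≡ ℕ→ℚ a + ℕ→ℚ b
ℕ→ℚ-+ a b = sym (trans (/-homo-+ (ℤ.+ a) (ℤ.+ b) 1 1)
  (/-cong (cong₂ ℤ._+_ (ℤ.*-identityʳ (ℤ.+ a)) (ℤ.*-identityʳ (ℤ.+ b))) refl))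

ℕ→ℚ-∸ : ∀ {a b} → b ≤ a → ℕ→ℚ (a ∸ b) ≡ ℕ→ℚ a + - ℕ→ℚ b
ℕ→ℚ-∸ {a} {b} b≤a = begin
  ℕ→ℚ (a ∸ b)                    ≡⟨ add-sub (ℕ→ℚ (a ∸ b)) (ℕ→ℚ b) ⟩
  ℕ→ℚ (a ∸ b) + ℕ→ℚ b + - ℕ→ℚ b  ≡⟨ cong (_+ - ℕ→ℚ b) (ℕ→ℚ-+ (a ∸ b) b) ⟨
  ℕ→ℚ (a ∸ b ℕ.+ b) + - ℕ→ℚ b    ≡⟨ cong (λ x → ℕ→ℚ x + - ℕ→ℚ b) (ℕ.m∸n+n≡m b≤a) ⟩
  ℕ→ℚ a + - ℕ→ℚ b                ∎
  where
  open ≡-Reasoning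
  add-sub : ∀ x y → x ≡ x + y + - y
  add-sub = solve-∀ ℚ-ring

ℕ→ℚ-suc-nonZero : ∀ k → NonZero (ℕ→ℚ (suc k))
ℕ→ℚ-suc-nonZero k = pos⇒nonZero (ℕ→ℚ (suc k)) {{normalize-pos (suc k) 1}}

p*q≡0⇒q≡0 : ∀ p .{{_ : NonZero p}} q → p * q ≡ 0ℚ → q ≡ 0ℚ
p*q≡0⇒q≡0 p q pq≡0 = begin
  q                ≡⟨ *-identityˡ q ⟨
  1ℚ * q           ≡⟨ cong (_* q) (*-inverseˡ p) ⟨
  (1/ p) * p * q   ≡⟨ *-assoc (1/ p) p q ⟩
  (1/ p) * (p * q) ≡⟨ cong ((1/ p) *_) pq≡0 ⟩
  (1/ p) * 0ℚ      ≡⟨ *-zeroʳ (1/ p) ⟩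
  0ℚ               ∎
  where open ≡-Reasoning

sumFrom-cong : ∀ a k {f g : ℕ → ℚ} → (∀ i → a ≤ i → i < a ℕ.+ k → f i ≡ g i) →
               sumFrom a k f ≡ sumFrom a k g
sumFrom-cong a zero    f≡g = refl
sumFrom-cong a (suc k) f≡g = cong₂ _+_
  (f≡g a ℕ.≤-refl (ℕ.m<m+n a (s≤s z≤n)))
  (sumFrom-cong (suc a) k λ i a<i i<a+k → f≡g i (ℕ.<⇒≤ a<i) (subst (i <_) (sym (ℕ.+-suc a k)) i<a+k))

sumFrom-+ : ∀ a k (f g : ℕ → ℚ) →
            sumFrom a k (λ i → f i + g i) ≡ sumFrom a k f + sumFrom a k g
sumFrom-+ a zero    f g = refl
sumFrom-+ a (suc k) f g = trans (cong (_+_ (f a + g a)) (sumFrom-+ (suc a) k f g))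
                                (interchange (f a) (g a) _ _)
  where
  interchange : ∀ x y z w → (x + y) + (z + w) ≡ (x + z) + (y + w)
  interchange = solve-∀ ℚ-ring

sumFrom-* : ∀ c a k (f : ℕ → ℚ) → sumFrom a k (λ i → c * f i) ≡ c * sumFrom a k f
sumFrom-* c a zero    f = sym (*-zeroʳ c)
sumFrom-* c a (suc k) f = trans (cong (_+_ (c * f a)) (sumFrom-* c (suc a) k f))
                                (sym (*-distribˡ-+ c (f a) _))

sumFrom-neg : ∀ a k (f : ℕ → ℚ) → sumFrom a k (λ i → - f i) ≡ - sumFrom a k f
sumFrom-neg a zero    f = refl
sumFrom-neg a (suc k) f = trans (cong (_+_ (- f a)) (sumFrom-neg (suc a) k f))
                                (sym (neg-distrib-+ (f a) _))

sumFrom-suc : ∀ a k (f : ℕ → ℚ) → sumFrom (suc a) k f ≡ sumFrom a k (λ i → f (suc i))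
sumFrom-suc a zero    f = refl
sumFrom-suc a (suc k) f = cong (_+_ (f (suc a))) (sumFrom-suc (suc a) k f)

sumFrom-snoc : ∀ a k (f : ℕ → ℚ) → sumFrom a (suc k) f ≡ sumFrom a k f + f (a ℕ.+ k)
sumFrom-snoc a zero    f = trans (+-identityʳ (f a))
  (trans (cong f (sym (ℕ.+-identityʳ a))) (sym (+-identityˡ _)))
sumFrom-snoc a (suc k) f = begin
  f a + sumFrom (suc a) (suc k) f                ≡⟨ cong (_+_ (f a)) (sumFrom-snoc (suc a) k f) ⟩
  f a + (sumFrom (suc a) k f + f (suc a ℕ.+ k))  ≡⟨ +-assoc (f a) _ _ ⟨
  f a + sumFrom (suc a) k f + f (suc a ℕ.+ k)    ≡⟨ cong (λ i → f a + sumFrom (suc a) k f + f i) (ℕ.+-suc a k) ⟨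
  f a + sumFrom (suc a) k f + f (a ℕ.+ suc k)    ∎
  where open ≡-Reasoning

_/[_!*_!] : ℕ → ℕ → ℕ → ℚ
a /[ m !* r !] = (ℤ.+ a / (m ! ℕ.* r !)) {{m ℕ.!* r !≢0}}

ℕ→ℚ-*-/[!*!] : ∀ c a m r → ℕ→ℚ c * a /[ m !* r !] ≡ (c ℕ.* a) /[ m !* r !]
ℕ→ℚ-*-/[!*!] c a m r = ℕ→ℚ-*-/ c a (m ! ℕ.* r !) {{m ℕ.!* r !≢0}}

/[!*!]-cancelˡ : ∀ a m r → (suc m ℕ.* a) /[ suc m !* r !] ≡ a /[ m !* r !]
/[!*!]-cancelˡ a m r = trans
  (/-cong {{suc m ℕ.!* r !≢0}} {{nonZero}} (ℤ.pos-* (suc m) a) (ℕ.*-assoc (suc m) (m !) (r !)))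
  (*-cancelˡ-/ (suc m) {ℤ.+ a} {{m ℕ.!* r !≢0}} {{nonZero}})
  where nonZero = ℕ.m*n≢0 (suc m) (m ! ℕ.* r !) {{_}} {{m ℕ.!* r !≢0}}

/[!*!]-cancelʳ : ∀ a m r → (suc r ℕ.* a) /[ m !* suc r !] ≡ a /[ m !* r !]
/[!*!]-cancelʳ a m r = trans
  (/-cong {{m ℕ.!* suc r !≢0}} {{nonZero}} (ℤ.pos-* (suc r) a) (*-swap (m !) (suc r) (r !)))
  (*-cancelˡ-/ (suc r) {ℤ.+ a} {{m ℕ.!* r !≢0}} {{nonZero}})
  where
  nonZero = ℕ.m*n≢0 (suc r) (m ! ℕ.* r !) {{_}} {{m ℕ.!* r !≢0}}
  *-swap : ∀ x y z → x ℕ.* (y ℕ.* z) ≡ y ℕ.* (x ℕ.* z)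
  *-swap = ℕ-Solver.solve-∀

term-suc-exponent : ∀ n k r → term (suc n) k r ≡ ℕ→ℚ (k ∸ r) * term n k r
term-suc-exponent n k r = sym (ℕ→ℚ-*-/[!*!] (k ∸ r) ((k ∸ r) ℕ.^ n) (k ∸ r) r)

term-suc-index : ∀ n k r → ℕ→ℚ (suc r) * term n (suc k) (suc r) ≡ term n k r
term-suc-index n k r = trans (ℕ→ℚ-*-/[!*!] (suc r) ((k ∸ r) ℕ.^ n) (k ∸ r) (suc r))
                             (/[!*!]-cancelʳ ((k ∸ r) ℕ.^ n) (k ∸ r) r)

term-1-suc : ∀ k r → r ≤ k → term 1 (suc k) r ≡ term 0 k r
term-1-suc k r r≤k = cancel (ℕ.+-∸-assoc 1 r≤k)
  where
  cancel : ∀ {m e} → m ≡ suc e → (m ℕ.^ 1) /[ m !* r !] ≡ 1 /[ e !* r !]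
  cancel {e = e} refl = /[!*!]-cancelˡ 1 e r

term-diagonal : ∀ n k → term (suc n) k k ≡ 0ℚ
term-diagonal n k = trans (/-cong {{k ∸ k ℕ.!* k !≢0}} {{k ∸ k ℕ.!* k !≢0}}
                                  (cong (λ e → ℤ.+ (e ℕ.* e ℕ.^ n)) (ℕ.n∸n≡0 k)) refl)
                          (0/n≡0 _ {{k ∸ k ℕ.!* k !≢0}})

sign-index-sum≡-h : ∀ n k →
  sumFrom 0 (suc (suc k)) (λ r → sign r * (ℕ→ℚ r * term n (suc k) r)) ≡ - h n k
sign-index-sum≡-h n k = begin
  sumFrom 0 (suc (suc k)) (λ r → sign r * (ℕ→ℚ r * term n (suc k) r))
    ≡⟨ drop-zero (term n (suc k) 0) _ ⟩
  sumFrom 1 (suc k) (λ r → sign r * (ℕ→ℚ r * term n (suc k) r))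
    ≡⟨ sumFrom-suc 0 (suc k) (λ r → sign r * (ℕ→ℚ r * term n (suc k) r)) ⟩
  sumFrom 0 (suc k) (λ r → - sign r * (ℕ→ℚ (suc r) * term n (suc k) (suc r)))
    ≡⟨ sumFrom-cong 0 (suc k) (λ r _ _ → trans (sym (neg-distribˡ-* (sign r) _))
                                                (cong (λ t → - (sign r * t)) (term-suc-index n k r))) ⟩
  sumFrom 0 (suc k) (λ r → - (sign r * term n k r))
    ≡⟨ sumFrom-neg 0 (suc k) (λ r → sign r * term n k r) ⟩
  - h n k ∎
  where
  open ≡-Reasoning
  drop-zero : ∀ t s → 1ℚ * (0ℚ * t) + s ≡ s
  drop-zero = solve-∀ ℚ-ring

h-suc : ∀ n k → h (suc n) (suc k) ≡ ℕ→ℚ (suc k) * h n (suc k) + h n k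
h-suc n k = begin
  h (suc n) K
    ≡⟨ sumFrom-cong 0 (suc K) (λ r _ r<2+k → expand r (ℕ.≤-pred r<2+k)) ⟩
  sumFrom 0 (suc K) (λ r → ℕ→ℚ K * f r + - g r)
    ≡⟨ sumFrom-+ 0 (suc K) (λ r → ℕ→ℚ K * f r) (λ r → - g r) ⟩
  sumFrom 0 (suc K) (λ r → ℕ→ℚ K * f r) + sumFrom 0 (suc K) (λ r → - g r)
    ≡⟨ cong₂ _+_ (sumFrom-* (ℕ→ℚ K) 0 (suc K) f) (sumFrom-neg 0 (suc K) g) ⟩
  ℕ→ℚ K * h n K + - sumFrom 0 (suc K) g
    ≡⟨ cong (λ s → ℕ→ℚ K * h n K + - s) (sign-index-sum≡-h n k) ⟩
  ℕ→ℚ K * h n K + - - h n k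
    ≡⟨ cong (_+_ (ℕ→ℚ K * h n K)) (+-Group.⁻¹-involutive (h n k)) ⟩
  ℕ→ℚ K * h n K + h n k ∎
  where
  open ≡-Reasoning
  K = suc k
  f g : ℕ → ℚ
  f r = sign r * term n K r
  g r = sign r * (ℕ→ℚ r * term n K r)
  distribute : ∀ s x y t → s * ((x + - y) * t) ≡ x * (s * t) + - (s * (y * t))
  distribute = solve-∀ ℚ-ring
  expand : ∀ r → r ≤ K → sign r * term (suc n) K r ≡ ℕ→ℚ K * f r + - g r
  expand r r≤K = begin
    sign r * term (suc n) K r                     ≡⟨ cong (sign r *_) (term-suc-exponent n K r) ⟩
    sign r * (ℕ→ℚ (K ∸ r) * term n K r)          ≡⟨ cong (λ x → sign r * (x * term n K r)) (ℕ→ℚ-∸ r≤K) ⟩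
    sign r * ((ℕ→ℚ K + - ℕ→ℚ r) * term n K r)    ≡⟨ distribute (sign r) (ℕ→ℚ K) (ℕ→ℚ r) (term n K r) ⟩
    ℕ→ℚ K * f r + - g r                           ∎

h-1-suc : ∀ k → h 1 (suc k) ≡ h 0 k
h-1-suc k = begin
  h 1 (suc k)
    ≡⟨ sumFrom-snoc 0 (suc k) (λ r → sign r * term 1 (suc k) r) ⟩
  sumFrom 0 (suc k) (λ r → sign r * term 1 (suc k) r) + sign (suc k) * term 1 (suc k) (suc k)
    ≡⟨ cong₂ _+_ (sumFrom-cong 0 (suc k) λ r _ r<1+k → cong (sign r *_) (term-1-suc k r (ℕ.≤-pred r<1+k)))
                 (cong (sign (suc k) *_) (term-diagonal 0 (suc k))) ⟩
  h 0 k + sign (suc k) * 0ℚ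
    ≡⟨ cong (_+_ (h 0 k)) (*-zeroʳ (sign (suc k))) ⟩
  h 0 k + 0ℚ
    ≡⟨ +-identityʳ (h 0 k) ⟩
  h 0 k ∎
  where open ≡-Reasoning

h-0-suc : ∀ k → h 0 (suc k) ≡ 0ℚ
h-0-suc k = p*q≡0⇒q≡0 (ℕ→ℚ (suc k)) {{ℕ→ℚ-suc-nonZero k}} (h 0 (suc k))
  (+-Group.identityˡ-unique _ (h 0 k) (trans (sym (h-suc 0 k)) (h-1-suc k)))

h-vanish : ∀ {n k} → n < k → h n k ≡ 0ℚ
h-vanish {zero}  {suc k} _ = h-0-suc k
h-vanish {suc n} {suc k} (s≤s n<k) = begin
  h (suc n) (suc k)
    ≡⟨ h-suc n k ⟩
  ℕ→ℚ (suc k) * h n (suc k) + h n k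
    ≡⟨ cong₂ (λ x y → ℕ→ℚ (suc k) * x + y) (h-vanish (ℕ.m≤n⇒m≤1+n n<k)) (h-vanish n<k) ⟩
  ℕ→ℚ (suc k) * 0ℚ + 0ℚ
    ≡⟨ trans (+-identityʳ _) (*-zeroʳ (ℕ→ℚ (suc k))) ⟩
  0ℚ ∎
  where open ≡-Reasoning

h-suc-zero : ∀ n → h (suc n) 0 ≡ 0ℚ
h-suc-zero n = refl

weighted-h-suc : ∀ (a : ℕ → ℚ) n →
  sumFrom 1 (suc (suc n)) (λ k → a k * h (suc (suc n)) k) ≡
  sumFrom 1 (suc n) (λ k → (a k * ℕ→ℚ k + a (suc k)) * h (suc n) k)
weighted-h-suc a n = begin
  sumFrom 1 (suc N) (λ k → a k * h (suc N) k)
    ≡⟨ sumFrom-suc 0 (suc N) (λ k → a k * h (suc N) k) ⟩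
  sumFrom 0 (suc N) (λ j → a (suc j) * h (suc N) (suc j))
    ≡⟨ sumFrom-cong 0 (suc N) (λ j _ _ → split j) ⟩
  sumFrom 0 (suc N) (λ j → up (suc j) + down j)
    ≡⟨ sumFrom-+ 0 (suc N) (λ j → up (suc j)) down ⟩
  sumFrom 0 (suc N) (λ j → up (suc j)) + sumFrom 0 (suc N) down
    ≡⟨ cong₂ _+_ drop-top drop-bottom ⟩
  sumFrom 1 N up + sumFrom 1 N down
    ≡⟨ sumFrom-+ 1 N up down ⟨
  sumFrom 1 N (λ k → up k + down k)
    ≡⟨ sumFrom-cong 1 N (λ k _ _ → sym (*-distribʳ-+ (h N k) (a k * ℕ→ℚ k) (a (suc k)))) ⟩
  sumFrom 1 N (λ k → (a k * ℕ→ℚ k + a (suc k)) * h N k) ∎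
  where
  open ≡-Reasoning
  N = suc n
  up down : ℕ → ℚ
  up k   = a k * ℕ→ℚ k * h N k
  down k = a (suc k) * h N k
  regroup : ∀ x y z w → x * (y * z + w) ≡ x * y * z + x * w
  regroup = solve-∀ ℚ-ring
  split : ∀ j → a (suc j) * h (suc N) (suc j) ≡ up (suc j) + down j
  split j = trans (cong (a (suc j) *_) (h-suc N j)) (regroup (a (suc j)) _ _ _)
  drop-top : sumFrom 0 (suc N) (λ j → up (suc j)) ≡ sumFrom 1 N up
  drop-top = begin
    sumFrom 0 (suc N) (λ j → up (suc j))    ≡⟨ sumFrom-snoc 0 N (λ j → up (suc j)) ⟩
    sumFrom 0 N (λ j → up (suc j)) + up (suc N)
      ≡⟨ cong (λ x → sumFrom 0 N (λ j → up (suc j)) + a (suc N) * ℕ→ℚ (suc N) * x) (h-vanish (ℕ.n<1+n N)) ⟩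
    sumFrom 0 N (λ j → up (suc j)) + a (suc N) * ℕ→ℚ (suc N) * 0ℚ
      ≡⟨ cong (_+_ (sumFrom 0 N (λ j → up (suc j)))) (*-zeroʳ (a (suc N) * ℕ→ℚ (suc N))) ⟩
    sumFrom 0 N (λ j → up (suc j)) + 0ℚ      ≡⟨ +-identityʳ _ ⟩
    sumFrom 0 N (λ j → up (suc j))           ≡⟨ sumFrom-suc 0 N up ⟨
    sumFrom 1 N up                           ∎
  drop-bottom : sumFrom 0 (suc N) down ≡ sumFrom 1 N down
  drop-bottom = begin
    a 1 * h N 0 + sumFrom 1 N down  ≡⟨ cong (λ x → a 1 * x + sumFrom 1 N down) (h-suc-zero n) ⟩
    a 1 * 0ℚ + sumFrom 1 N down     ≡⟨ cong (_+ sumFrom 1 N down) (*-zeroʳ (a 1)) ⟩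
    0ℚ + sumFrom 1 N down           ≡⟨ +-identityˡ _ ⟩
    sumFrom 1 N down                ∎

weight : ℕ → ℚ
weight k = ℕ→ℚ (2 ℕ.* k ∸ 1)

Ch : ℕ → ℚ
Ch m = Σ[ 1 ⋯ m ] (λ j → C j * h m j)

v-weighted : ∀ n → v n ≡ Σ[ 1 ⋯ n ] (λ k → weight k * h n k)
v-weighted n = sumFrom-cong 1 n λ k _ _ →
  trans (sumFrom-cong 0 (suc k) λ r _ _ → reorder (sign r) (weight k) (term n k r))
        (sumFrom-* (weight k) 0 (suc k) (λ r → sign r * term n k r))
  where
  reorder : ∀ s w t → s * w * t ≡ w * (s * t)
  reorder = solve-∀ ℚ-ring

weight-step : ∀ k → weight (suc k) * ℕ→ℚ (suc k) + weight (suc (suc k)) ≡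
                    ℕ→ℚ 3 * weight (suc k) + C (suc k)
-- C K has a negative coefficient, so 5K is first added to both sides; what remains is an
-- identity between natural numbers, transported along ℕ→ℚ.
weight-step k = begin
  W₁ * ℕ→ℚ K + W₂                          ≡⟨ add-sub (W₁ * ℕ→ℚ K + W₂) F₅ ⟩
  W₁ * ℕ→ℚ K + W₂ + F₅ + - F₅            ≡⟨ cong (_+ - F₅) lifted ⟩
  ℕ→ℚ 3 * W₁ + F₂ + ℕ→ℚ 4 + - F₅        ≡⟨ regroup (ℕ→ℚ 3 * W₁) F₂ (ℕ→ℚ 4) F₅ ⟩
  ℕ→ℚ 3 * W₁ + C K                         ∎
  where
  open ≡-Reasoning
  K = suc k
  n₁ = 2 ℕ.* K ∸ 1
  n₂ = 2 ℕ.* suc K ∸ 1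
  W₁ = ℕ→ℚ n₁
  W₂ = ℕ→ℚ n₂
  F₂ = ℕ→ℚ (2 ℕ.* K ℕ.* K)
  F₅ = ℕ→ℚ (5 ℕ.* K)
  add-sub : ∀ x y → x ≡ x + y + - y
  add-sub = solve-∀ ℚ-ring
  regroup : ∀ x y z w → x + y + z + - w ≡ x + (y + - w + z)
  regroup = solve-∀ ℚ-ring
  2[1+m]∸1≡1+2m : ∀ m → 2 ℕ.* suc m ∸ 1 ≡ suc (2 ℕ.* m)
  2[1+m]∸1≡1+2m m = ℕ.+-suc m (m ℕ.+ 0)
  polynomial : ∀ k → suc (2 ℕ.* k) ℕ.* suc k ℕ.+ suc (2 ℕ.* suc k) ℕ.+ 5 ℕ.* suc k
                   ≡ 3 ℕ.* suc (2 ℕ.* k) ℕ.+ 2 ℕ.* suc k ℕ.* suc k ℕ.+ 4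
  polynomial = ℕ-Solver.solve-∀
  identity : n₁ ℕ.* K ℕ.+ n₂ ℕ.+ 5 ℕ.* K ≡ 3 ℕ.* n₁ ℕ.+ 2 ℕ.* K ℕ.* K ℕ.+ 4
  identity = substitute (2[1+m]∸1≡1+2m k) (2[1+m]∸1≡1+2m K)
    where
    substitute : ∀ {a b} → a ≡ suc (2 ℕ.* k) → b ≡ suc (2 ℕ.* K) →
                 a ℕ.* K ℕ.+ b ℕ.+ 5 ℕ.* K ≡ 3 ℕ.* a ℕ.+ 2 ℕ.* K ℕ.* K ℕ.+ 4
    substitute refl refl = polynomial k
  lifted : W₁ * ℕ→ℚ K + W₂ + F₅ ≡ ℕ→ℚ 3 * W₁ + F₂ + ℕ→ℚ 4
  lifted = begin
    W₁ * ℕ→ℚ K + W₂ + F₅                          ≡⟨ cong (λ x → x + W₂ + F₅) (ℕ→ℚ-* n₁ K) ⟨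
    ℕ→ℚ (n₁ ℕ.* K) + W₂ + F₅                      ≡⟨ cong (_+ F₅) (ℕ→ℚ-+ (n₁ ℕ.* K) n₂) ⟨
    ℕ→ℚ (n₁ ℕ.* K ℕ.+ n₂) + F₅                    ≡⟨ ℕ→ℚ-+ (n₁ ℕ.* K ℕ.+ n₂) (5 ℕ.* K) ⟨
    ℕ→ℚ (n₁ ℕ.* K ℕ.+ n₂ ℕ.+ 5 ℕ.* K)             ≡⟨ cong ℕ→ℚ identity ⟩
    ℕ→ℚ (3 ℕ.* n₁ ℕ.+ 2 ℕ.* K ℕ.* K ℕ.+ 4)        ≡⟨ ℕ→ℚ-+ (3 ℕ.* n₁ ℕ.+ 2 ℕ.* K ℕ.* K) 4 ⟩
    ℕ→ℚ (3 ℕ.* n₁ ℕ.+ 2 ℕ.* K ℕ.* K) + ℕ→ℚ 4     ≡⟨ cong (_+ ℕ→ℚ 4) (ℕ→ℚ-+ (3 ℕ.* n₁) (2 ℕ.* K ℕ.* K)) ⟩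
    ℕ→ℚ (3 ℕ.* n₁) + F₂ + ℕ→ℚ 4                   ≡⟨ cong (λ x → x + F₂ + ℕ→ℚ 4) (ℕ→ℚ-* 3 n₁) ⟩
    ℕ→ℚ 3 * W₁ + F₂ + ℕ→ℚ 4                       ∎

v-step : ∀ n → v (suc (suc n)) ≡ ℕ→ℚ 3 * v (suc n) + Ch (suc n)
v-step n = begin
  v (suc N)
    ≡⟨ v-weighted (suc N) ⟩
  sumFrom 1 (suc N) (λ k → weight k * h (suc N) k)
    ≡⟨ weighted-h-suc weight n ⟩
  sumFrom 1 N (λ k → (weight k * ℕ→ℚ k + weight (suc k)) * h N k)
    ≡⟨ sumFrom-cong 1 N (λ k 1≤k _ → split k 1≤k) ⟩
  sumFrom 1 N (λ k → ℕ→ℚ 3 * (weight k * h N k) + C k * h N k)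
    ≡⟨ sumFrom-+ 1 N (λ k → ℕ→ℚ 3 * (weight k * h N k)) (λ k → C k * h N k) ⟩
  sumFrom 1 N (λ k → ℕ→ℚ 3 * (weight k * h N k)) + Ch N
    ≡⟨ cong (_+ Ch N) (sumFrom-* (ℕ→ℚ 3) 1 N (λ k → weight k * h N k)) ⟩
  ℕ→ℚ 3 * sumFrom 1 N (λ k → weight k * h N k) + Ch N
    ≡⟨ cong (λ x → ℕ→ℚ 3 * x + Ch N) (v-weighted N) ⟨
  ℕ→ℚ 3 * v N + Ch N ∎
  where
  open ≡-Reasoning
  N = suc n
  distribute : ∀ t w c x → (t * w + c) * x ≡ t * (w * x) + c * x
  distribute = solve-∀ ℚ-ring
  split : ∀ k → 1 ≤ k →
          (weight k * ℕ→ℚ k + weight (suc k)) * h N k ≡ ℕ→ℚ 3 * (weight k * h N k) + C k * h N k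
  split (suc k) _ = trans (cong (_* h N (suc k)) (weight-step k))
                          (distribute (ℕ→ℚ 3) (weight (suc k)) (C (suc k)) (h N (suc k)))

unfold-recurrence : ∀ b (x s : ℕ → ℚ) → (∀ n → x (suc (suc n)) ≡ ℕ→ℚ b * x (suc n) + s (suc n)) →
  ∀ m → x (suc m) ≡ ℕ→ℚ (b ℕ.^ m) * x 1 + sumFrom 1 m (λ j → ℕ→ℚ (b ℕ.^ (m ∸ j)) * s j)
unfold-recurrence b x s step zero = sym (trans (+-identityʳ (1ℚ * x 1)) (*-identityˡ (x 1)))
unfold-recurrence b x s step (suc m) = begin
  x (suc (suc m))
    ≡⟨ step m ⟩
  B * x (suc m) + s (suc m)
    ≡⟨ cong (λ y → B * y + s (suc m)) (unfold-recurrence b x s step m) ⟩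
  B * (ℕ→ℚ (b ℕ.^ m) * x 1 + S) + s (suc m)
    ≡⟨ distribute B (ℕ→ℚ (b ℕ.^ m)) (x 1) S (s (suc m)) ⟩
  B * ℕ→ℚ (b ℕ.^ m) * x 1 + (B * S + 1ℚ * s (suc m))
    ≡⟨ cong (λ y → y * x 1 + (B * S + 1ℚ * s (suc m))) (ℕ→ℚ-* b (b ℕ.^ m)) ⟨
  ℕ→ℚ (b ℕ.^ suc m) * x 1 + (B * S + 1ℚ * s (suc m))
    ≡⟨ cong₂ (λ y z → ℕ→ℚ (b ℕ.^ suc m) * x 1 + (y + z)) scaled-sum top-term ⟩
  ℕ→ℚ (b ℕ.^ suc m) * x 1 + (sumFrom 1 m g′ + g′ (suc m))
    ≡⟨ cong (_+_ (ℕ→ℚ (b ℕ.^ suc m) * x 1)) (sumFrom-snoc 1 m g′) ⟨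
  ℕ→ℚ (b ℕ.^ suc m) * x 1 + sumFrom 1 (suc m) g′ ∎
  where
  open ≡-Reasoning
  B = ℕ→ℚ b
  g g′ : ℕ → ℚ
  g  j = ℕ→ℚ (b ℕ.^ (m ∸ j)) * s j
  g′ j = ℕ→ℚ (b ℕ.^ (suc m ∸ j)) * s j
  S = sumFrom 1 m g
  distribute : ∀ b p y S t → b * (p * y + S) + t ≡ b * p * y + (b * S + 1ℚ * t)
  distribute = solve-∀ ℚ-ring
  top-term : 1ℚ * s (suc m) ≡ g′ (suc m)
  top-term = cong (λ e → ℕ→ℚ (b ℕ.^ e) * s (suc m)) (sym (ℕ.n∸n≡0 m))
  lower : ∀ j → j ≤ m → B * g j ≡ g′ j
  lower j j≤m = begin
    B * (ℕ→ℚ (b ℕ.^ (m ∸ j)) * s j)   ≡⟨ *-assoc B _ (s j) ⟨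
    B * ℕ→ℚ (b ℕ.^ (m ∸ j)) * s j     ≡⟨ cong (_* s j) (ℕ→ℚ-* b (b ℕ.^ (m ∸ j))) ⟨
    ℕ→ℚ (b ℕ.^ suc (m ∸ j)) * s j     ≡⟨ cong (λ e → ℕ→ℚ (b ℕ.^ e) * s j) (ℕ.+-∸-assoc 1 j≤m) ⟨
    g′ j                               ∎
  scaled-sum : B * S ≡ sumFrom 1 m g′
  scaled-sum = trans (sym (sumFrom-* B 1 m g))
                     (sumFrom-cong 1 m λ j _ j<1+m → lower j (ℕ.≤-pred j<1+m))

proposition6 : (n : ℕ) → 2 ≤ n →
    v n ≡ ℕ→ℚ (3 ℕ.^ (n ∸ 1)) * v 1 + R n
proposition6 (suc m) _ = unfold-recurrence 3 v Ch v-step m
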